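{- Let $d\ge1$ and write $A_j(d,t)=\sum_{k=0}^{d-1}a_j(d,k)t^k$. For all $1\le j\le d$ the coefficients of $A_j(d,t)$ are unimodal. More specifically, if $d$ is even then $a_j(d,0)\le\cdots\le a_j(d,\tfrac d2-1)\ge\cdots\ge a_j(d,d-1)$ if $1\le j\le\tfrac d2$, and $a_j(d,0)\le\cdots\le a_j(d,\tfrac d2)\ge\cdots\ge a_j(d,d-1)$ if $\tfrac d2<j\le d$; and if $d\ge3$ is odd then $a_1(d,0)\le\cdots\le a_1(d,\lfloor\tfrac d2\rfloor-1)=a_1(d,\lfloor\tfrac d2\rfloor)\ge\cdots\ge a_1(d,d-1)$, $a_d(d,0)\le\cdots\le a_d(d,\lfloor\tfrac d2\rfloor)=a_d(d,\lfloor\tfrac d2\rfloor+1)\ge\cdots\ge a_d(d,d-1)$, and $a_j(d,0)\le\cdots\le a_j(d,\lfloor\tfrac d2\rfloor)\ge\cdots\ge a_j(d,d-1)$ for $2\le j\le d-1$.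
   Context: For $\sigma=\sigma_1\cdots\sigma_d\in S_d$, $\operatorname{des}(\sigma)=|\{i\in[d-1]:\sigma_i>\sigma_{i+1}\}|$. For $1\le j\le d$, $a_j(d,k)$ is the number of $\sigma\in S_d$ with $\sigma_d=d+1-j$ and $\operatorname{des}(\sigma)=k$, and $A_j(d,t)=\sum_{k=0}^{d-1}a_j(d,k)t^k$. -}

module Defs where

open import Data.Nat using (ℕ; zero; suc; _+_; _∸_; _≤_; _<_; _<ᵇ_)
open import Data.Bool using (true; false; if_then_else_)
open import Data.Fin using (Fin; toℕ)
import Data.Fin.Properties as FinP
open import Data.List using (List; []; _∷_; concatMap; map; filter; length; allFin)
import Data.List.Relation.Unary.Unique.DecPropositional as UDec
open import Data.Product using (_×_; ∃)

-- All words of length n over the alphabet Fin d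
-- (the letter i : Fin d stands for the value toℕ i + 1 ∈ [d]).
words : (d n : ℕ) → List (List (Fin d))
words d zero    = [] ∷ []
words d (suc n) = concatMap (λ w → map (_∷ w) (allFin d)) (words d n)

-- S d : all permutations σ = σ₁⋯σ_d ∈ S_d in one-line notation,
-- i.e. the words of length d over [d] with pairwise distinct letters.
S : (d : ℕ) → List (List (Fin d))
S d = filter (UDec.unique? (FinP._≟_ {d})) (words d d)

des : ∀ {d} → List (Fin d) → ℕ
des []       = 0
des (x ∷ xs) = go x xs
  where
  go : ∀ {d} → Fin d → List (Fin d) → ℕ
  go x []       = 0
  go x (y ∷ ys) = (if toℕ y <ᵇ toℕ x then 1 else 0) + go y ys

-- value of the last letter σ_d, as an element of [d] = {1,…,d} (0 for the empty word)
lastVal : ∀ {d} → List (Fin d) → ℕ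
lastVal []           = 0
lastVal (x ∷ [])     = suc (toℕ x)
lastVal (x ∷ y ∷ xs) = lastVal (y ∷ xs)

open import Data.Nat.Properties using (_≟_)
open import Relation.Nullary.Decidable using (_×-dec_)

a : (j d k : ℕ) → ℕ
a j d k = length (filter (λ σ → (lastVal σ ≟ (d + 1) ∸ j) ×-dec (des σ ≟ k)) (S d))

PeakAt : (ℕ → ℕ) → (m d : ℕ) → Set
PeakAt f m d = (∀ k → suc k ≤ m → f k ≤ f (suc k))
             × (∀ k → m ≤ k → suc k ≤ d ∸ 1 → f (suc k) ≤ f k)

Unimodal : (ℕ → ℕ) → ℕ → Set
Unimodal f d = ∃ λ m → m ≤ d ∸ 1 × PeakAt f m d

-- Appending a last letter v to a permutation τ of [d] (shifting the letters ≥ v up) turns the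
-- pair (last value, descents) into a recurrence
--   a_j(d+1,k) = Σ_{i<j} a_i(d,k-1) + Σ_{j≤i≤d} a_i(d,k),
-- as the new last letter creates a descent exactly when it does not exceed the old one.  The recurrence
-- alone yields the symmetry a_{i+1}(d,x) = a_{r+1}(d,y) for i + r = x + y = d - 1, by reversing the
-- order of summation.  Rises a_j(d+1,s) ≤ a_j(d+1,s+1) up to the middle follow by induction on d:
-- pair the i-th summand with the (d+1-i)-th; either a summand rises by induction, or by symmetry
-- the two exchange their values between s and s+1.  Falls after the middle are, by symmetry, rises
-- of a_{d+1-j} read backwards.

module Submission where

open import Defs
open import Data.Nat using (ℕ; zero; suc; _+_; _*_; _∸_; _≤_; _<_; _<ᵇ_; z≤n; s≤s; z<s; s<s)
open import Data.Nat.Properties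
open import Data.Bool using (Bool; true; false; if_then_else_; T)
open import Data.Fin as Fin using (Fin; toℕ; punchIn; punchOut)
import Data.Fin.Properties as Fin
open import Data.List using (List; []; _∷_; map; filter; length; allFin; _++_; _∷ʳ_; cartesianProductWith; concat; tabulate; _∷ʳ′_; initLast)
import Data.List.Properties as List
open import Data.List.Relation.Unary.All as All using (All; []; _∷_)
import Data.List.Relation.Unary.All.Properties as All
open import Data.List.Relation.Unary.Any using (here)
open import Data.List.Relation.Unary.AllPairs using ([]; _∷_)
open import Data.List.Relation.Unary.Unique.Propositional using (Unique)
import Data.List.Relation.Unary.Unique.Propositional.Properties as Unique
open import Data.List.Membership.Propositional using (_∈_)
import Data.List.Membership.Propositional.Properties as ∈
open import Data.List.Membership.Propositional.Properties.WithK using (unique∧set⇒bag)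
open import Data.List.Relation.Binary.BagAndSetEquality using (∼bag⇒↭)
open import Data.List.Relation.Binary.Permutation.Propositional using (_↭_)
import Data.List.Relation.Binary.Permutation.Propositional.Properties as ↭
open import Data.Product using (_×_; _,_; ∃; proj₁; proj₂)
open import Data.Sum using (_⊎_; inj₁; inj₂)
open import Data.Empty using (⊥-elim)
open import Data.Unit using (tt)
open import Function using (_∘_; id; _⇔_; mk⇔; Equivalence)
open import Relation.Binary.PropositionalEquality
open import Relation.Nullary using (Dec; yes; no; ¬_)
open import Relation.Nullary.Decidable using (_×-dec_)
open import Data.Nat.Tactic.RingSolver using (solve-∀)

-- Permutations listed by their last letter

∈-words⇒length : ∀ d n {w} → w ∈ words d n → length w ≡ n
∈-words⇒length d zero    (here refl) = refl
∈-words⇒length d (suc n) w∈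
  with vs , w∈vs , vs∈ ← ∈.∈-concat⁻′ (map (λ w → map (_∷ w) (allFin d)) (words d n)) w∈
  with u , u∈ , refl ← ∈.∈-map⁻ (λ w → map (_∷ w) (allFin d)) vs∈
  with x , _ , refl ← ∈.∈-map⁻ (_∷ u) w∈vs
  = cong suc (∈-words⇒length d n u∈)

length⇒∈-words : ∀ d n (w : List (Fin d)) → length w ≡ n → w ∈ words d n
length⇒∈-words d zero    []      refl = here refl
length⇒∈-words d (suc n) (x ∷ w) refl =
  ∈.∈-concat⁺′ (∈.∈-map⁺ (_∷ w) (∈.∈-allFin x))
               (∈.∈-map⁺ (λ w → map (_∷ w) (allFin d)) (length⇒∈-words d n w refl))

concat-map≡cartesianProductWith : ∀ {A B C : Set} (f : A → B → C) xs ys →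
  concat (map (λ x → map (f x) ys) xs) ≡ cartesianProductWith f xs ys
concat-map≡cartesianProductWith f []       ys = refl
concat-map≡cartesianProductWith f (x ∷ xs) ys =
  cong (map (f x) ys ++_) (concat-map≡cartesianProductWith f xs ys)

words-unique : ∀ d n → Unique (words d n)
words-unique d zero    = [] ∷ []
words-unique d (suc n) =
  subst Unique (sym (concat-map≡cartesianProductWith (λ w x → x ∷ w) (words d n) (allFin d)))
    (Unique.cartesianProductWith⁺ (λ w x → x ∷ w) ∷-inj (words-unique d n) (Unique.allFin⁺ d))
  where
  ∷-inj : ∀ {w x : List (Fin d)} {y z} → y ∷ w ≡ z ∷ x → w ≡ x × y ≡ z
  ∷-inj refl = refl , refl

S-unique : ∀ d → Unique (S d)
S-unique d = Unique.filter⁺ _ (words-unique d d)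

∈-S⇔ : ∀ d {σ} → σ ∈ S d ⇔ (length σ ≡ d × Unique σ)
∈-S⇔ d {σ} = mk⇔
  (λ σ∈ → let w∈ , u = ∈.∈-filter⁻ _ σ∈ in ∈-words⇒length d d w∈ , u)
  (λ (l , u) → ∈.∈-filter⁺ _ (length⇒∈-words d d σ l) u)

extend : ∀ {d} → List (Fin d) → Fin (suc d) → List (Fin (suc d))
extend τ v = map (punchIn v) τ ∷ʳ v

-- Every permutation of [d+1] is  extend τ v  for exactly one pair: v is its last letter and τ the
-- standardisation of the other letters.
perms : (d : ℕ) → List (List (Fin d))
perms zero    = [] ∷ []
perms (suc d) = cartesianProductWith extend (perms d) (allFin (suc d))

extend-injective : ∀ {d} {τ τ′ : List (Fin d)} {v v′} →
                   extend τ v ≡ extend τ′ v′ → τ ≡ τ′ × v ≡ v′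
extend-injective {τ = τ} {τ′} {v} {v′} eq with List.∷ʳ-injective (map (punchIn v) τ) (map (punchIn v′) τ′) eq
... | eq′ , refl = List.map-injective (Fin.punchIn-injective v _ _) eq′ , refl

perms-unique : ∀ d → Unique (perms d)
perms-unique zero    = [] ∷ []
perms-unique (suc d) = Unique.cartesianProductWith⁺ extend extend-injective (perms-unique d) (Unique.allFin⁺ (suc d))

Unique-∷ʳ⁺ : ∀ {A : Set} {v : A} {u} → Unique u → All (_≢ v) u → Unique (u ∷ʳ v)
Unique-∷ʳ⁺ []       []       = [] ∷ []
Unique-∷ʳ⁺ (x∉ ∷ u) (x≢ ∷ ≢) = All.∷ʳ⁺ x∉ x≢ ∷ Unique-∷ʳ⁺ u ≢

Unique-∷ʳ⁻ : ∀ {A : Set} {v : A} u → Unique (u ∷ʳ v) → Unique u × All (_≢ v) u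
Unique-∷ʳ⁻ []      _          = [] , []
Unique-∷ʳ⁻ (x ∷ u) (x∉ ∷ uv) =
  let u-unique , ≢v = Unique-∷ʳ⁻ u uv ; x∉u , x≢v = All.∷ʳ⁻ x∉ in
  (x∉u ∷ u-unique) , (x≢v ∷ ≢v)

map-punchIn-avoids : ∀ {d} (v : Fin (suc d)) τ → All (_≢ v) (map (punchIn v) τ)
map-punchIn-avoids v []      = []
map-punchIn-avoids v (x ∷ τ) = Fin.punchInᵢ≢i v x ∷ map-punchIn-avoids v τ

map-punchIn-surjective : ∀ {d} (v : Fin (suc d)) {u} → All (_≢ v) u → ∃ λ τ → map (punchIn v) τ ≡ u
map-punchIn-surjective v []         = [] , refl
map-punchIn-surjective v (x≢v ∷ ≢v) =
  let τ , eq = map-punchIn-surjective v ≢v in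
  punchOut (x≢v ∘ sym) ∷ τ , cong₂ _∷_ (Fin.punchIn-punchOut (x≢v ∘ sym)) eq

∈-perms⇒ : ∀ d {σ} → σ ∈ perms d → length σ ≡ d × Unique σ
∈-perms⇒ zero    (here refl) = refl , []
∈-perms⇒ (suc d) σ∈
  with τ , v , τ∈ , _ , refl ← ∈.∈-cartesianProductWith⁻ extend (perms d) (allFin (suc d)) σ∈ =
  let l , u = ∈-perms⇒ d τ∈ in
  trans (List.length-++ (map (punchIn v) τ)) (trans (+-comm _ 1) (cong suc (trans (List.length-map _ τ) l))) ,
  Unique-∷ʳ⁺ (Unique.map⁺ (Fin.punchIn-injective v _ _) u) (map-punchIn-avoids v τ)

⇒∈-perms : ∀ d (σ : List (Fin d)) → length σ ≡ d → Unique σ → σ ∈ perms d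
⇒∈-perms zero    []  refl _ = here refl
⇒∈-perms (suc d) σ l σ-unique with initLast σ
... | u ∷ʳ′ v with Unique-∷ʳ⁻ u σ-unique
... | u-unique , ≢v with map-punchIn-surjective v ≢v
... | τ , refl =
  ∈.∈-cartesianProductWith⁺ extend (⇒∈-perms d τ length-τ (Unique.map⁻ u-unique)) (∈.∈-allFin v)
  where
  length-τ : length τ ≡ d
  length-τ = suc-injective (begin
    suc (length τ)                    ≡⟨ cong suc (List.length-map (punchIn v) τ) ⟨
    suc (length (map (punchIn v) τ))  ≡⟨ +-comm 1 _ ⟩
    length (map (punchIn v) τ) + 1    ≡⟨ List.length-++ (map (punchIn v) τ) ⟨
    length (extend τ v)               ≡⟨ l ⟩
    suc d                             ∎)
    where open ≡-Reasoning

S↭perms : ∀ d → S d ↭ perms d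
S↭perms d = ∼bag⇒↭ (unique∧set⇒bag (S-unique d) (perms-unique d) (mk⇔
  (λ σ∈ → let l , u = Equivalence.to (∈-S⇔ d) σ∈ in ⇒∈-perms d _ l u)
  (λ σ∈ → Equivalence.from (∈-S⇔ d) (∈-perms⇒ d σ∈))))

Counted : (j d k : ℕ) → List (Fin d) → Set
Counted j d k σ = lastVal σ ≡ (d + 1) ∸ j × des σ ≡ k

counted? : ∀ j d k σ → Dec (Counted j d k σ)
counted? j d k σ = (lastVal σ ≟ (d + 1) ∸ j) ×-dec (des σ ≟ k)

aₚ : (j d k : ℕ) → ℕ
aₚ j d k = length (filter (counted? j d k) (perms d))

a≡aₚ : ∀ j d k → a j d k ≡ aₚ j d k
a≡aₚ j d k = ↭.↭-length (↭.filter-↭ (counted? j d k) (S↭perms d))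

𝟙< : ℕ → ℕ → ℕ
𝟙< m n = if m <ᵇ n then 1 else 0

lastVal-∷ʳ : ∀ {d} (u : List (Fin d)) v → lastVal (u ∷ʳ v) ≡ suc (toℕ v)
lastVal-∷ʳ []          v = refl
lastVal-∷ʳ (x ∷ [])    v = refl
lastVal-∷ʳ (x ∷ y ∷ u) v = lastVal-∷ʳ (y ∷ u) v

des-∷ʳ : ∀ {d} (u : List (Fin d)) v → des (u ∷ʳ v) ≡ des u + 𝟙< (suc (toℕ v)) (lastVal u)
des-∷ʳ []          v = refl
des-∷ʳ (x ∷ [])    v = +-identityʳ (𝟙< (toℕ v) (toℕ x))
des-∷ʳ (x ∷ y ∷ u) v = trans (cong (𝟙< (toℕ y) (toℕ x) +_) (des-∷ʳ (y ∷ u) v))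
                             (sym (+-assoc (𝟙< (toℕ y) (toℕ x)) (des (y ∷ u)) _))

punchIn-<ᵇ : ∀ {d} (v : Fin (suc d)) x y → (toℕ (punchIn v y) <ᵇ toℕ (punchIn v x)) ≡ (toℕ y <ᵇ toℕ x)
punchIn-<ᵇ Fin.zero    x          y          = refl
punchIn-<ᵇ (Fin.suc v) Fin.zero    Fin.zero    = refl
punchIn-<ᵇ (Fin.suc v) Fin.zero    (Fin.suc y) = refl
punchIn-<ᵇ (Fin.suc v) (Fin.suc x) Fin.zero    = refl
punchIn-<ᵇ (Fin.suc v) (Fin.suc x) (Fin.suc y) = punchIn-<ᵇ v x y

des-map-punchIn : ∀ {d} (v : Fin (suc d)) τ → des (map (punchIn v) τ) ≡ des τ
des-map-punchIn v []          = refl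
des-map-punchIn v (x ∷ [])    = refl
des-map-punchIn v (x ∷ y ∷ τ) =
  cong₂ (λ b r → (if b then 1 else 0) + r) (punchIn-<ᵇ v x y) (des-map-punchIn v (y ∷ τ))

<ᵇ-punchIn : ∀ {d} (v : Fin (suc d)) x → (toℕ v <ᵇ toℕ (punchIn v x)) ≡ (toℕ v <ᵇ suc (toℕ x))
<ᵇ-punchIn Fin.zero    x           = refl
<ᵇ-punchIn (Fin.suc v) Fin.zero    = refl
<ᵇ-punchIn (Fin.suc v) (Fin.suc x) = <ᵇ-punchIn v x

𝟙<-lastVal-map-punchIn : ∀ {d} (v : Fin (suc d)) τ →
  𝟙< (suc (toℕ v)) (lastVal (map (punchIn v) τ)) ≡ 𝟙< (toℕ v) (lastVal τ)
𝟙<-lastVal-map-punchIn v []          = refl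
𝟙<-lastVal-map-punchIn v (x ∷ [])    = cong (λ b → if b then 1 else 0) (<ᵇ-punchIn v x)
𝟙<-lastVal-map-punchIn v (x ∷ y ∷ τ) = 𝟙<-lastVal-map-punchIn v (y ∷ τ)

lastVal-extend : ∀ {d} (τ : List (Fin d)) v → lastVal (extend τ v) ≡ suc (toℕ v)
lastVal-extend τ v = lastVal-∷ʳ (map (punchIn v) τ) v

-- toℕ v counts from 0 and lastVal from 1, so this tests whether v is at most the old last letter.
des-extend : ∀ {d} (τ : List (Fin d)) v → des (extend τ v) ≡ des τ + 𝟙< (toℕ v) (lastVal τ)
des-extend τ v = trans (des-∷ʳ (map (punchIn v) τ) v)
                       (cong₂ _+_ (des-map-punchIn v τ) (𝟙<-lastVal-map-punchIn v τ))

-- Finite sums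

𝟙 : ∀ {P : Set} → Dec P → ℕ
𝟙 (yes _) = 1
𝟙 (no _)  = 0

𝟙-cong : ∀ {P Q : Set} → (P → Q) → (Q → P) → (p : Dec P) (q : Dec Q) → 𝟙 p ≡ 𝟙 q
𝟙-cong P⇒Q Q⇒P (yes p) (yes q) = refl
𝟙-cong P⇒Q Q⇒P (yes p) (no ¬q) = ⊥-elim (¬q (P⇒Q p))
𝟙-cong P⇒Q Q⇒P (no ¬p) (yes q) = ⊥-elim (¬p (Q⇒P q))
𝟙-cong P⇒Q Q⇒P (no ¬p) (no ¬q) = refl

𝟙-no : ∀ {P : Set} → ¬ P → (p : Dec P) → 𝟙 p ≡ 0
𝟙-no ¬P (yes p) = ⊥-elim (¬P p)
𝟙-no ¬P (no _)  = refl

sumOver : ∀ {A : Set} → (A → ℕ) → List A → ℕ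
sumOver f []       = 0
sumOver f (x ∷ xs) = f x + sumOver f xs

length-filter≡sumOver-𝟙 : ∀ {A : Set} {P : A → Set} (P? : ∀ x → Dec (P x)) xs →
  length (filter P? xs) ≡ sumOver (𝟙 ∘ P?) xs
length-filter≡sumOver-𝟙 P? []       = refl
length-filter≡sumOver-𝟙 P? (x ∷ xs) with P? x
... | yes _ = cong suc (length-filter≡sumOver-𝟙 P? xs)
... | no _  = length-filter≡sumOver-𝟙 P? xs

sumOver-cong : ∀ {A : Set} {f g : A → ℕ} xs → All (λ x → f x ≡ g x) xs → sumOver f xs ≡ sumOver g xs
sumOver-cong []       []       = refl
sumOver-cong (x ∷ xs) (e ∷ es) = cong₂ _+_ e (sumOver-cong xs es)

sumOver-++ : ∀ {A : Set} (f : A → ℕ) xs ys → sumOver f (xs ++ ys) ≡ sumOver f xs + sumOver f ys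
sumOver-++ f []       ys = refl
sumOver-++ f (x ∷ xs) ys = trans (cong (f x +_) (sumOver-++ f xs ys)) (sym (+-assoc (f x) _ _))

sumOver-map : ∀ {A B : Set} (f : B → ℕ) (g : A → B) xs → sumOver f (map g xs) ≡ sumOver (f ∘ g) xs
sumOver-map f g []       = refl
sumOver-map f g (x ∷ xs) = cong (f (g x) +_) (sumOver-map f g xs)

sumOver-cartesianProductWith : ∀ {A B C : Set} (f : C → ℕ) (h : A → B → C) xs ys →
  sumOver f (cartesianProductWith h xs ys) ≡ sumOver (λ x → sumOver (λ y → f (h x y)) ys) xs
sumOver-cartesianProductWith f h []       ys = refl
sumOver-cartesianProductWith f h (x ∷ xs) ys =
  trans (sumOver-++ f (map (h x) ys) _)
        (cong₂ _+_ (sumOver-map f (h x) ys) (sumOver-cartesianProductWith f h xs ys))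

∑ : ℕ → (ℕ → ℕ) → ℕ
∑ zero    f = 0
∑ (suc n) f = f 0 + ∑ n (f ∘ suc)

∑-cong : ∀ n {f g : ℕ → ℕ} → (∀ i → i < n → f i ≡ g i) → ∑ n f ≡ ∑ n g
∑-cong zero    e = refl
∑-cong (suc n) e = cong₂ _+_ (e 0 z<s) (∑-cong n (λ i i<n → e (suc i) (s<s i<n)))

∑-zero : ∀ n → ∑ n (λ _ → 0) ≡ 0
∑-zero zero    = refl
∑-zero (suc n) = ∑-zero n

∑-+ : ∀ n (f g : ℕ → ℕ) → ∑ n (λ i → f i + g i) ≡ ∑ n f + ∑ n g
∑-+ zero    f g = refl
∑-+ (suc n) f g = trans (cong (f 0 + g 0 +_) (∑-+ n (f ∘ suc) (g ∘ suc)))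
                        (+-interchange (f 0) (g 0) (∑ n (f ∘ suc)) (∑ n (g ∘ suc)))
  where
  +-interchange : ∀ a b c d → a + b + (c + d) ≡ a + c + (b + d)
  +-interchange = solve-∀

∑-single : ∀ n m (f : ℕ → ℕ) → m < n → (∀ i → i ≢ m → f i ≡ 0) → ∑ n f ≡ f m
∑-single (suc n) zero    f _         f≡0 =
  trans (cong (f 0 +_) (trans (∑-cong n (λ i _ → f≡0 (suc i) λ ())) (∑-zero n))) (+-identityʳ _)
∑-single (suc n) (suc m) f (s<s m<n) f≡0 =
  trans (cong (_+ ∑ n (f ∘ suc)) (f≡0 0 λ ()))
        (∑-single n m (f ∘ suc) m<n (λ i i≢m → f≡0 (suc i) (i≢m ∘ suc-injective)))

∑-last : ∀ n (f : ℕ → ℕ) → ∑ (suc n) f ≡ ∑ n f + f n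
∑-last zero    f = +-comm (f 0) 0
∑-last (suc n) f = trans (cong (f 0 +_) (∑-last n (f ∘ suc))) (sym (+-assoc (f 0) _ _))

∑-reverse : ∀ n (f : ℕ → ℕ) → ∑ n f ≡ ∑ n (λ i → f (n ∸ suc i))
∑-reverse zero    f = refl
∑-reverse (suc n) f = trans (∑-last n f) (trans (+-comm (∑ n f) (f n)) (cong (f n +_) (∑-reverse n f)))

∑-mono-≤ : ∀ n {f g : ℕ → ℕ} → (∀ i → i < n → f i ≤ g i) → ∑ n f ≤ ∑ n g
∑-mono-≤ zero    e = z≤n
∑-mono-≤ (suc n) e = +-mono-≤ (e 0 z<s) (∑-mono-≤ n (λ i i<n → e (suc i) (s<s i<n)))

sumOver-∑ : ∀ {A : Set} n (f : A → ℕ → ℕ) xs →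
            sumOver (λ x → ∑ n (f x)) xs ≡ ∑ n (λ i → sumOver (λ x → f x i) xs)
sumOver-∑ n f []       = sym (∑-zero n)
sumOver-∑ n f (x ∷ xs) = trans (cong (∑ n (f x) +_) (sumOver-∑ n f xs)) (sym (∑-+ n (f x) _))

sumOver-tabulate : ∀ {A : Set} n (h : Fin n → A) (f : A → ℕ) (g : ℕ → ℕ) →
  (∀ i → f (h i) ≡ g (toℕ i)) → sumOver f (tabulate h) ≡ ∑ n g
sumOver-tabulate zero    h f g e = refl
sumOver-tabulate (suc n) h f g e =
  cong₂ _+_ (e Fin.zero) (sumOver-tabulate n (h ∘ Fin.suc) f (g ∘ suc) (e ∘ Fin.suc))

-- The recurrence

shift : (ℕ → ℕ) → ℕ → ℕ
shift f zero    = 0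
shift f (suc k) = f k

shiftIf : Bool → (ℕ → ℕ) → ℕ → ℕ
shiftIf b f = if b then shift f else f

shiftIf-cong : ∀ b {f g : ℕ → ℕ} → (∀ k → f k ≡ g k) → ∀ k → shiftIf b f k ≡ shiftIf b g k
shiftIf-cong false f≗g k       = f≗g k
shiftIf-cong true  f≗g zero    = refl
shiftIf-cong true  f≗g (suc k) = f≗g k

shiftIf-zero : ∀ b {f : ℕ → ℕ} → (∀ k → f k ≡ 0) → ∀ k → shiftIf b f k ≡ 0
shiftIf-zero false f≡0 k       = f≡0 k
shiftIf-zero true  f≡0 zero    = refl
shiftIf-zero true  f≡0 (suc k) = f≡0 k

shiftIf-𝟙≟ : ∀ b n k → shiftIf b (λ k → 𝟙 (n ≟ k)) k ≡ 𝟙 (n + (if b then 1 else 0) ≟ k)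
shiftIf-𝟙≟ false n k       = 𝟙-cong (trans (+-identityʳ n)) (trans (sym (+-identityʳ n))) _ _
shiftIf-𝟙≟ true  n zero    = sym (𝟙-no (λ eq → 1+n≢0 (trans (+-comm 1 n) eq)) _)
shiftIf-𝟙≟ true  n (suc k) = 𝟙-cong (λ eq → trans (+-comm n 1) (cong suc eq))
                                    (λ eq → suc-injective (trans (+-comm 1 n) eq)) _ _

shiftIf-< : ∀ {m n} → m < n → ∀ f k → shiftIf (m <ᵇ n) f k ≡ shift f k
shiftIf-< {m} {n} m<n f k with m <ᵇ n | <⇒<ᵇ m<n
... | true | _ = refl

shiftIf-≮ : ∀ {m n} → ¬ m < n → ∀ f k → shiftIf (m <ᵇ n) f k ≡ f k
shiftIf-≮ {m} {n} m≮n f k with m <ᵇ n in eq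
... | false = refl
... | true  = ⊥-elim (m≮n (<ᵇ⇒< m n (subst T (sym eq) tt)))

sumOver-shiftIf : ∀ {A : Set} b (f : A → ℕ → ℕ) k xs →
  sumOver (λ x → shiftIf b (f x) k) xs ≡ shiftIf b (λ k → sumOver (λ x → f x k) xs) k
sumOver-shiftIf false f k       xs = refl
sumOver-shiftIf true  f (suc k) xs = refl
sumOver-shiftIf true  f zero    []       = refl
sumOver-shiftIf true  f zero    (x ∷ xs) = sumOver-shiftIf true f zero xs

<ᵇ-cong : ∀ {m n p q} → (m < n → p < q) → (p < q → m < n) → (m <ᵇ n) ≡ (p <ᵇ q)
<ᵇ-cong {m} {n} {p} {q} ⇒ ⇐ with m <ᵇ n in eq₁ | p <ᵇ q in eq₂
... | false | false = refl
... | true  | true  = refl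
... | true  | false = ⊥-elim (subst T eq₂ (<⇒<ᵇ (⇒ (<ᵇ⇒< m n (subst T (sym eq₁) tt)))))
... | false | true  = ⊥-elim (subst T eq₁ (<⇒<ᵇ (⇐ (<ᵇ⇒< p q (subst T (sym eq₂) tt)))))

-- Both sides say  D + 2 ≤ j + L.
<ᵇ-transpose-∸ : ∀ D L j → L ≤ D → j ≤ suc D → (suc (D ∸ L) <ᵇ j) ≡ (suc D ∸ j <ᵇ L)
<ᵇ-transpose-∸ D L j L≤D j≤1+D
  with p , refl ← m≤n⇒∃[o]m+o≡n L≤D | q , eq ← m≤n⇒∃[o]m+o≡n j≤1+D =
  trans (cong (λ x → suc x <ᵇ j) (m+n∸m≡n L p)) (trans (<ᵇ-cong ⇒ ⇐) (cong (_<ᵇ L) (sym 1+D∸j≡q)))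
  where
  1+D∸j≡q : suc (L + p) ∸ j ≡ q
  1+D∸j≡q = trans (cong (_∸ j) (sym eq)) (m+n∸m≡n j q)
  ⇒ : suc p < j → q < L
  ⇒ h = +-cancelʳ-≤ p (suc q) L (≤-trans (≤-reflexive (cong suc (+-comm q p)))
          (≤-pred (≤-trans (+-monoˡ-≤ q h) (≤-reflexive eq))))
  ⇐ : q < L → suc p < j
  ⇐ h = +-cancelʳ-≤ q (suc (suc p)) j (≤-trans (≤-reflexive (cong suc (sym (+-suc p q))))
          (≤-trans (+-monoʳ-≤ (suc p) h) (≤-reflexive (trans (cong suc (+-comm p L)) (sym eq)))))

lastVal≤ : ∀ {d} (τ : List (Fin d)) → lastVal τ ≤ d
lastVal≤ []          = z≤n
lastVal≤ (x ∷ [])    = Fin.toℕ<n x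
lastVal≤ (x ∷ y ∷ τ) = lastVal≤ (y ∷ τ)

lastVal-nonempty : ∀ {d} (x : Fin d) τ → 1 ≤ lastVal (x ∷ τ)
lastVal-nonempty x []      = s≤s z≤n
lastVal-nonempty x (y ∷ τ) = lastVal-nonempty y τ

perms-lastVal : ∀ d → 1 ≤ d → All (λ τ → 1 ≤ lastVal τ × lastVal τ ≤ d) (perms d)
perms-lastVal d 1≤d = All.tabulate λ {τ} τ∈ → bounds τ (proj₁ (∈-perms⇒ d τ∈))
  where
  bounds : ∀ (τ : List (Fin d)) → length τ ≡ d → 1 ≤ lastVal τ × lastVal τ ≤ d
  bounds []      refl = ⊥-elim (<-irrefl refl 1≤d)
  bounds (x ∷ τ) _    = lastVal-nonempty x τ , lastVal≤ (x ∷ τ)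

module Recurrence (D j : ℕ) (1≤j : 1 ≤ j) (j≤1+D : j ≤ suc D) where

  m : ℕ
  m = suc D ∸ j

  extensions-counted : ∀ k τ →
    sumOver (λ v → 𝟙 (counted? j (suc D) k (extend τ v))) (allFin (suc D)) ≡ 𝟙 (des τ + 𝟙< m (lastVal τ) ≟ k)
  extensions-counted k τ = begin
    sumOver (λ v → 𝟙 (counted? j (suc D) k (extend τ v))) (allFin (suc D))
      ≡⟨ sumOver-tabulate (suc D) id _ f (λ v → 𝟙-cong (⇒ v) (⇐ v) _ _) ⟩
    ∑ (suc D) f
      ≡⟨ ∑-single (suc D) m f (s≤s (∸-monoʳ-≤ (suc D) 1≤j)) (λ t t≢m → 𝟙-no (t≢m ∘ proj₁) _) ⟩
    f m
      ≡⟨ 𝟙-cong proj₂ (refl ,_) _ _ ⟩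
    𝟙 (des τ + 𝟙< m (lastVal τ) ≟ k) ∎
    where
    open ≡-Reasoning
    f : ℕ → ℕ
    f t = 𝟙 ((t ≟ m) ×-dec (des τ + 𝟙< t (lastVal τ) ≟ k))
    last≡ : (suc D + 1) ∸ j ≡ suc m
    last≡ = trans (cong (_∸ j) (+-comm (suc D) 1)) (+-∸-assoc 1 j≤1+D)
    ⇒ : ∀ v → Counted j (suc D) k (extend τ v) → toℕ v ≡ m × des τ + 𝟙< (toℕ v) (lastVal τ) ≡ k
    ⇒ v (last , descents) = suc-injective (trans (sym (lastVal-extend τ v)) (trans last last≡)) ,
                            trans (sym (des-extend τ v)) descents
    ⇐ : ∀ v → toℕ v ≡ m × des τ + 𝟙< (toℕ v) (lastVal τ) ≡ k → Counted j (suc D) k (extend τ v)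
    ⇐ v (last , descents) = trans (lastVal-extend τ v) (trans (cong suc last) (sym last≡)) ,
                            trans (des-extend τ v) descents

  split-by-lastVal : ∀ k τ → 1 ≤ lastVal τ → lastVal τ ≤ D →
    𝟙 (des τ + 𝟙< m (lastVal τ) ≟ k) ≡
    ∑ D (λ i → shiftIf (suc i <ᵇ j) (λ k → 𝟙 (counted? (suc i) D k τ)) k)
  split-by-lastVal k τ 1≤L L≤D = sym (begin
    ∑ D g
      ≡⟨ ∑-single D i₀ g i₀<D g≡0 ⟩
    shiftIf (suc i₀ <ᵇ j) (λ k → 𝟙 (counted? (suc i₀) D k τ)) k
      ≡⟨ shiftIf-cong (suc i₀ <ᵇ j) counted⇔des k ⟩
    shiftIf (suc i₀ <ᵇ j) (λ k → 𝟙 (des τ ≟ k)) k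
      ≡⟨ shiftIf-𝟙≟ (suc i₀ <ᵇ j) (des τ) k ⟩
    𝟙 (des τ + (if suc i₀ <ᵇ j then 1 else 0) ≟ k)
      ≡⟨ cong (λ b → 𝟙 (des τ + (if b then 1 else 0) ≟ k)) (<ᵇ-transpose-∸ D L j L≤D j≤1+D) ⟩
    𝟙 (des τ + 𝟙< m L ≟ k)
      ∎)
    where
    open ≡-Reasoning
    L = lastVal τ
    i₀ = D ∸ L
    g : ℕ → ℕ
    g i = shiftIf (suc i <ᵇ j) (λ k → 𝟙 (counted? (suc i) D k τ)) k
    i₀<D : i₀ < D
    i₀<D = ∸-monoʳ-< {m = D} {n = L} {o = 0} 1≤L L≤D
    lastVal-index : ∀ i → (D + 1) ∸ suc i ≡ D ∸ i
    lastVal-index i = cong (_∸ suc i) (+-comm D 1)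
    counted⇔des : ∀ k → 𝟙 (counted? (suc i₀) D k τ) ≡ 𝟙 (des τ ≟ k)
    counted⇔des k = 𝟙-cong proj₂ (sym (trans (lastVal-index i₀) (m∸[m∸n]≡n L≤D)) ,_) _ _
    g≡0 : ∀ i → i ≢ i₀ → g i ≡ 0
    g≡0 i i≢i₀ = shiftIf-zero (suc i <ᵇ j) (λ k → 𝟙-no (L≢ ∘ proj₁) _) k
      where
      L≢ : L ≢ (D + 1) ∸ suc i
      L≢ eq with i ≤? D
      ... | yes i≤D = i≢i₀ (sym (trans (cong (D ∸_) (trans eq (lastVal-index i))) (m∸[m∸n]≡n i≤D)))
      ... | no  i≰D = <-irrefl (sym (trans (trans eq (lastVal-index i)) (m≤n⇒m∸n≡0 (<⇒≤ (≰⇒> i≰D))))) 1≤L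

  aₚ-recurrence : 1 ≤ D → ∀ k → aₚ j (suc D) k ≡ ∑ D (λ i → shiftIf (suc i <ᵇ j) (aₚ (suc i) D) k)
  aₚ-recurrence 1≤D k = begin
    aₚ j (suc D) k
      ≡⟨ length-filter≡sumOver-𝟙 (counted? j (suc D) k) (perms (suc D)) ⟩
    sumOver (𝟙 ∘ counted? j (suc D) k) (perms (suc D))
      ≡⟨ sumOver-cartesianProductWith (𝟙 ∘ counted? j (suc D) k) extend (perms D) (allFin (suc D)) ⟩
    sumOver (λ τ → sumOver (λ v → 𝟙 (counted? j (suc D) k (extend τ v))) (allFin (suc D))) (perms D)
      ≡⟨ sumOver-cong (perms D) (All.tabulate λ {τ} _ → extensions-counted k τ) ⟩
    sumOver (λ τ → 𝟙 (des τ + 𝟙< m (lastVal τ) ≟ k)) (perms D)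
      ≡⟨ sumOver-cong (perms D)
           (All.map (λ {τ} (1≤L , L≤D) → split-by-lastVal k τ 1≤L L≤D) (perms-lastVal D 1≤D)) ⟩
    sumOver (λ τ → ∑ D (λ i → shiftIf (suc i <ᵇ j) (λ k → 𝟙 (counted? (suc i) D k τ)) k)) (perms D)
      ≡⟨ sumOver-∑ D _ (perms D) ⟩
    ∑ D (λ i → sumOver (λ τ → shiftIf (suc i <ᵇ j) (λ k → 𝟙 (counted? (suc i) D k τ)) k) (perms D))
      ≡⟨ ∑-cong D (λ i _ → sumOver-shiftIf (suc i <ᵇ j) _ k (perms D)) ⟩
    ∑ D (λ i → shiftIf (suc i <ᵇ j) (λ k → sumOver (𝟙 ∘ counted? (suc i) D k) (perms D)) k)
      ≡⟨ ∑-cong D (λ i _ → shiftIf-cong (suc i <ᵇ j) (λ k → sym (length-filter≡sumOver-𝟙 _ (perms D))) k) ⟩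
    ∑ D (λ i → shiftIf (suc i <ᵇ j) (aₚ (suc i) D) k) ∎
    where open ≡-Reasoning

-- The recurrence of the header, summed over i - 1.
E : ℕ → ℕ → ℕ → ℕ
E j zero          k       = 0
E j (suc zero)    zero    = 1
E j (suc zero)    (suc k) = 0
E j (suc (suc D)) k       = ∑ (suc D) (λ i → shiftIf (suc i <ᵇ j) (E (suc i) (suc D)) k)

aₚ≡E : ∀ d j → 1 ≤ j → j ≤ d → ∀ k → aₚ j d k ≡ E j d k
aₚ≡E (suc zero)    (suc zero) _   _      zero    = refl
aₚ≡E (suc zero)    (suc zero) _   _      (suc k) = refl
aₚ≡E (suc zero)    (suc (suc j)) _ (s≤s ())
aₚ≡E (suc (suc D)) j          1≤j j≤2+D  k       =
  trans (Recurrence.aₚ-recurrence (suc D) j 1≤j j≤2+D (s≤s z≤n) k)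
        (∑-cong (suc D) λ i i<1+D →
          shiftIf-cong (suc i <ᵇ j) (aₚ≡E (suc D) (suc i) (s≤s z≤n) i<1+D) k)

a≡E : ∀ {d j} → 1 ≤ j → j ≤ d → ∀ k → a j d k ≡ E j d k
a≡E {d} {j} 1≤j j≤d k = trans (a≡aₚ j d k) (aₚ≡E d j 1≤j j≤d k)

summand : ℕ → ℕ → ℕ → ℕ → ℕ
summand d j k i = shiftIf (suc i <ᵇ j) (E (suc i) d) k

shiftIf-vanishes : ∀ b {f : ℕ → ℕ} n → (∀ k → n ≤ k → f k ≡ 0) →
                   ∀ k → suc n ≤ k → shiftIf b f k ≡ 0
shiftIf-vanishes false n f≡0 k       1+n≤k       = f≡0 k (≤-trans (n≤1+n n) 1+n≤k)
shiftIf-vanishes true  n f≡0 (suc k) (s≤s n≤k) = f≡0 k n≤k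

-- Vanishing, symmetry and rises of the recurrence

E-vanishes : ∀ d j k → d ≤ k → E j d k ≡ 0
E-vanishes zero          j k       _   = refl
E-vanishes (suc zero)    j (suc k) _   = refl
E-vanishes (suc (suc D)) j k       d≤k =
  trans (∑-cong (suc D) λ i _ → shiftIf-vanishes (suc i <ᵇ j) (suc D) (E-vanishes (suc D) (suc i)) k d≤k)
        (∑-zero (suc D))

<-mirror : ∀ t t′ i r → suc (t + t′) ≡ i + r → t < i → r ≤ t′
<-mirror t t′ i r eq t<i = +-cancelˡ-≤ (suc t) r t′ (≤-trans (+-monoˡ-≤ r t<i) (≤-reflexive (sym eq)))

≮-mirror : ∀ t t′ i r → suc (t + t′) ≡ i + r → ¬ t < i → t′ < r
≮-mirror t t′ i r eq t≮i =
  +-cancelˡ-≤ i (suc t′) r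
    (≤-trans (+-monoˡ-≤ (suc t′) (≮⇒≥ t≮i)) (≤-reflexive (trans (+-suc t t′) eq)))

E-symmetric : ∀ d i r x y → suc (i + r) ≡ d → suc (x + y) ≡ d → E (suc i) d x ≡ E (suc r) d y
E-symmetric (suc zero) zero zero zero zero refl refl = refl
E-symmetric (suc (suc D)) i r x y i+r x+y = begin
  ∑ (suc D) (summand (suc D) (suc i) x)
    ≡⟨ ∑-cong (suc D) mirror ⟩
  ∑ (suc D) (λ t → summand (suc D) (suc r) y (suc D ∸ suc t))
    ≡⟨ ∑-reverse (suc D) (summand (suc D) (suc r) y) ⟨
  ∑ (suc D) (summand (suc D) (suc r) y)
    ∎
  where
  open ≡-Reasoning
  shift-mirror : ∀ t t′ x y → suc (t + t′) ≡ suc D → suc (x + y) ≡ suc (suc D) →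
                 shift (E (suc t) (suc D)) x ≡ E (suc t′) (suc D) y
  shift-mirror t t′ zero    y t+t′ refl = sym (E-vanishes (suc D) (suc t′) (suc D) ≤-refl)
  shift-mirror t t′ (suc x) y t+t′ x+y  = E-symmetric (suc D) t t′ x y t+t′ (suc-injective x+y)
  mirror : ∀ t → t < suc D → summand (suc D) (suc i) x t ≡ summand (suc D) (suc r) y (suc D ∸ suc t)
  mirror t t<1+D = mirror′ t (suc D ∸ suc t) (m+[n∸m]≡n t<1+D)
    where
    mirror′ : ∀ t t′ → suc (t + t′) ≡ suc D → summand (suc D) (suc i) x t ≡ summand (suc D) (suc r) y t′
    mirror′ t t′ t+t′ with t <? i
    ... | yes t<i = begin
      summand (suc D) (suc i) x t    ≡⟨ shiftIf-< (s≤s t<i) _ x ⟩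
      shift (E (suc t) (suc D)) x    ≡⟨ shift-mirror t t′ x y t+t′ x+y ⟩
      E (suc t′) (suc D) y           ≡⟨ shiftIf-≮ (λ t′<r → <⇒≱ (≤-pred t′<r) r≤t′) _ y ⟨
      summand (suc D) (suc r) y t′   ∎
      where r≤t′ = <-mirror t t′ i r (trans t+t′ (suc-injective (sym i+r))) t<i
    ... | no t≮i = sym (begin
      summand (suc D) (suc r) y t′   ≡⟨ shiftIf-< (s≤s t′<r) _ y ⟩
      shift (E (suc t′) (suc D)) y   ≡⟨ shift-mirror t′ t y x (trans (cong suc (+-comm t′ t)) t+t′)
                                                          (trans (cong suc (+-comm y x)) x+y) ⟩
      E (suc t) (suc D) x            ≡⟨ shiftIf-≮ (t≮i ∘ ≤-pred) _ x ⟨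
      summand (suc D) (suc i) x t    ∎)
      where t′<r = ≮-mirror t t′ i r (trans t+t′ (suc-injective (sym i+r))) t≮i

mirror-involutive : ∀ n i → i < n → n ∸ suc (n ∸ suc i) ≡ i
mirror-involutive (suc n) i (s≤s i≤n) = m∸[m∸n]≡n i≤n

RisesOrSwaps : (f g : ℕ → ℕ) (i i′ : ℕ) → Set
RisesOrSwaps f g i i′ = f i ≤ g i ⊎ (f i ≡ g i′ × f i′ ≡ g i)

-- Summing each term with its mirror image, a term that does not rise is compensated by its partner.
∑-mono-≤-mirrored : ∀ n (f g : ℕ → ℕ) → (∀ i → i < n → RisesOrSwaps f g i (n ∸ suc i)) →
                    ∑ n f ≤ ∑ n g
∑-mono-≤-mirrored n f g step = halve (begin
  ∑ n f + ∑ n f                       ≡⟨ cong (∑ n f +_) (∑-reverse n f) ⟩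
  ∑ n f + ∑ n (λ i → f (n ∸ suc i))   ≡⟨ ∑-+ n f _ ⟨
  ∑ n (λ i → f i + f (n ∸ suc i))     ≤⟨ ∑-mono-≤ n pair ⟩
  ∑ n (λ i → g i + g (n ∸ suc i))     ≡⟨ ∑-+ n g _ ⟩
  ∑ n g + ∑ n (λ i → g (n ∸ suc i))   ≡⟨ cong (∑ n g +_) (∑-reverse n g) ⟨
  ∑ n g + ∑ n g                       ∎)
  where
  open ≤-Reasoning
  halve : ∀ {x y} → x + x ≤ y + y → x ≤ y
  halve {x} {y} 2x≤2y with x ≤? y
  ... | yes x≤y = x≤y
  ... | no  x≰y = ⊥-elim (<⇒≱ (+-mono-< (≰⇒> x≰y) (≰⇒> x≰y)) 2x≤2y)
  swapped : ∀ i i′ → f i ≡ g i′ → f i′ ≡ g i → f i + f i′ ≤ g i + g i′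
  swapped i i′ e e′ = ≤-reflexive (trans (cong₂ _+_ e e′) (+-comm (g i′) (g i)))
  pair : ∀ i → i < n → f i + f (n ∸ suc i) ≤ g i + g (n ∸ suc i)
  pair i i<n with step i i<n | step (n ∸ suc i) (∸-monoʳ-< {o = 0} (s≤s z≤n) i<n)
  ... | inj₂ (e , e′) | _              = swapped i (n ∸ suc i) e e′
  ... | inj₁ _        | inj₂ (e , e′) =
    swapped i (n ∸ suc i) (subst (λ t → f t ≡ g (n ∸ suc i)) (mirror-involutive n i i<n) e′)
                          (subst (λ t → f (n ∸ suc i) ≡ g t) (mirror-involutive n i i<n) e)
  ... | inj₁ ≤₁       | inj₁ ≤₂        = +-mono-≤ ≤₁ ≤₂

-- The rises  a_j(d,s) ≤ a_j(d,s+1)  proved by induction on d: every step before the middle, and the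
-- middle step in those cases where the theorem puts the peak to its right.  This family is closed under
-- the recurrence, which is why it, rather than the bare theorem, is the induction hypothesis.
data Rises (d j s : ℕ) : Set where
  before-middle : 3 + (s + s) ≤ d → Rises d j s
  even-middle   : 2 + (s + s) ≡ d → d < j + j → Rises d j s
  odd-middle    : 1 + (s + s) ≡ d → j ≡ d → 1 ≤ s → Rises d j s

half≤ : ∀ {i r d} → suc (i + r) ≡ d → ¬ d < suc i + suc i → suc i ≤ r
half≤ {i} {r} i+r d≮2i = +-cancelˡ-≤ (suc i) (suc i) r (≤-trans (≮⇒≥ d≮2i) (≤-reflexive (sym i+r)))

half< : ∀ {i r d j} → suc (i + r) ≡ d → suc d < j + j → j ≤ suc i → suc r < j
half< {i} {r} {d} {j} i+r 1+d<2j j≤1+i with suc r <? j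
... | yes r<j = r<j
... | no  r≮j = ⊥-elim (<⇒≱ 1+d<2j (begin
  j + j              ≤⟨ +-mono-≤ j≤1+i (≮⇒≥ r≮j) ⟩
  suc i + suc r      ≡⟨ cong suc (trans (+-suc i r) i+r) ⟩
  suc d              ∎))
  where open ≤-Reasoning

module RisingStep (D : ℕ) (rises : ∀ j s → Rises (suc D) j s → E j (suc D) s ≤ E j (suc D) (suc s)) where

  d : ℕ
  d = suc D

  Pair : (j s i r : ℕ) → Set
  Pair j s = RisesOrSwaps (summand d j s) (summand d j (suc s))

  shifted-rises : ∀ {j s i} → suc i < j → (∀ {s′} → s ≡ suc s′ → Rises d (suc i) s′) →
                  summand d j s i ≤ summand d j (suc s) i
  shifted-rises {j} {s} {i} i<j h = subst₂ _≤_ (sym (shiftIf-< i<j _ s)) (sym (shiftIf-< i<j _ (suc s))) (shift-rises s h)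
    where
    shift-rises : ∀ s → (∀ {s′} → s ≡ suc s′ → Rises d (suc i) s′) → shift (E (suc i) d) s ≤ E (suc i) d s
    shift-rises zero     _ = z≤n
    shift-rises (suc s′) h = rises (suc i) s′ (h refl)

  unshifted-rises : ∀ {j s i} → ¬ suc i < j → Rises d (suc i) s → summand d j s i ≤ summand d j (suc s) i
  unshifted-rises {j} {s} {i} i≮j h =
    subst₂ _≤_ (sym (shiftIf-≮ i≮j _ s)) (sym (shiftIf-≮ i≮j _ (suc s))) (rises (suc i) s h)

  symmetric-summands : ∀ j {i r x y k k′} → suc (i + r) ≡ d → suc (x + y) ≡ d →
    summand d j k i ≡ E (suc i) d x → summand d j k′ r ≡ E (suc r) d y → summand d j k i ≡ summand d j k′ r
  symmetric-summands j i+r x+y e e′ = trans e (trans (E-symmetric d _ _ _ _ i+r x+y) (sym e′))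

  before-middle-pair : ∀ j s → 3 + (s + s) ≤ suc d → ∀ i r → suc (i + r) ≡ d → Pair j s i r
  before-middle-pair j s 3+2s≤1+d i r i+r with suc i <? j
  ... | yes i<j = inj₁ (shifted-rises i<j λ { {s′} refl →
          before-middle (≤-trans (n≤1+n _)
            (≤-pred (subst (λ t → 3 + t ≤ suc d) (cong suc (+-suc s′ s′)) 3+2s≤1+d))) })
  ... | no i≮j with 3 + (s + s) ≤? d
  ...   | yes 3+2s≤d = inj₁ (unshifted-rises i≮j (before-middle 3+2s≤d))
  ...   | no 3+2s≰d with 2+2s≡d ← ≤-antisym (≤-pred 3+2s≤1+d) (≤-pred (≰⇒> 3+2s≰d)) | d <? suc i + suc i
  ...     | yes d<2i = inj₁ (unshifted-rises i≮j (even-middle 2+2s≡d d<2i))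
  ...     | no d≮2i =
    inj₂ ( symmetric-summands j i+r s+[1+s] (shiftIf-≮ i≮j (E (suc i) d) s) (shiftIf-≮ r≮j (E (suc r) d) (suc s))
         , symmetric-summands j (trans (cong suc (+-comm r i)) i+r) s+[1+s]
                              (shiftIf-≮ r≮j (E (suc r) d) s) (shiftIf-≮ i≮j (E (suc i) d) (suc s)) )
    where
    s+[1+s] : suc (s + suc s) ≡ d
    s+[1+s] = trans (cong suc (+-suc s s)) 2+2s≡d
    r≮j : ¬ suc r < j
    r≮j r<j = <-irrefl refl (≤-trans r<j (≤-trans (≮⇒≥ i≮j) (≤-trans (half≤ i+r d≮2i) (n≤1+n r))))

  even-middle-pair : ∀ j s → 2 + (s + s) ≡ suc d → suc d < j + j → ∀ i r → suc (i + r) ≡ d → Pair j s i r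
  even-middle-pair j s 2+2s≡1+d 1+d<2j i r i+r with suc i <? j
  ... | yes i<j = inj₁ (shifted-rises i<j λ { {s′} refl →
          before-middle (≤-reflexive (trans (cong (2 +_) (sym (+-suc s′ s′))) (suc-injective 2+2s≡1+d))) })
  even-middle-pair j zero refl 2<2j i r i+r | no i≮j = ⊥-elim (<⇒≱ 2<2j (+-mono-≤ j≤1 j≤1))
    where
    j≤1 : j ≤ 1
    j≤1 = ≤-trans (≮⇒≥ i≮j) (s≤s (≤-trans (m≤m+n i r) (≤-pred (≤-reflexive i+r))))
  even-middle-pair j (suc s′) 2+2s≡1+d 1+d<2j i r i+r | no i≮j with suc i ≟ d
  ... | yes 1+i≡d = inj₁ (unshifted-rises i≮j (odd-middle s+s 1+i≡d (s≤s z≤n)))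
    where s+s = suc-injective 2+2s≡1+d
  ... | no _ =
    inj₂ ( symmetric-summands j i+r s+s (shiftIf-≮ i≮j (E (suc i) d) (suc s′)) (shiftIf-< r<j (E (suc r) d) (2 + s′))
         , symmetric-summands j r+i s′+[1+s] (shiftIf-< r<j (E (suc r) d) (suc s′))
                                             (shiftIf-≮ i≮j (E (suc i) d) (2 + s′)) )
    where
    r<j = half< i+r 1+d<2j (≮⇒≥ i≮j)
    r+i = trans (cong suc (+-comm r i)) i+r
    s+s : suc (suc s′ + suc s′) ≡ d
    s+s = suc-injective 2+2s≡1+d
    s′+[1+s] : suc (s′ + suc (suc s′)) ≡ d
    s′+[1+s] = trans (cong suc (+-suc s′ (suc s′))) s+s

  odd-middle-pair : ∀ j s → 1 + (s + s) ≡ suc d → j ≡ suc d → 1 ≤ s →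
                    ∀ i r → suc (i + r) ≡ d → Pair j s i r
  odd-middle-pair j (suc s′) 1+2s≡1+d refl _ i r i+r =
    inj₂ ( symmetric-summands j i+r s′+s (shiftIf-< i<j (E (suc i) d) (suc s′)) (shiftIf-< r<j (E (suc r) d) (2 + s′))
         , symmetric-summands j r+i s′+s (shiftIf-< r<j (E (suc r) d) (suc s′)) (shiftIf-< i<j (E (suc i) d) (2 + s′)) )
    where
    r+i = trans (cong suc (+-comm r i)) i+r
    i<j : suc i < suc d
    i<j = s≤s (≤-trans (s≤s (m≤m+n i r)) (≤-reflexive i+r))
    r<j : suc r < suc d
    r<j = s≤s (≤-trans (s≤s (m≤m+n r i)) (≤-reflexive r+i))
    s′+s : suc (s′ + suc s′) ≡ d
    s′+s = suc-injective 1+2s≡1+d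

  E-rises-step : ∀ j s → Rises (suc d) j s → E j (suc d) s ≤ E j (suc d) (suc s)
  E-rises-step j s h = ∑-mono-≤-mirrored d (summand d j s) (summand d j (suc s)) λ i i<d →
    pair h i (d ∸ suc i) (m+[n∸m]≡n i<d)
    where
    pair : Rises (suc d) j s → ∀ i r → suc (i + r) ≡ d → Pair j s i r
    pair (before-middle 3+2s≤1+d)       = before-middle-pair j s 3+2s≤1+d
    pair (even-middle 2+2s≡1+d 1+d<2j)  = even-middle-pair j s 2+2s≡1+d 1+d<2j
    pair (odd-middle 1+2s≡1+d j≡1+d 1≤s) = odd-middle-pair j s 1+2s≡1+d j≡1+d 1≤s

E-rises : ∀ d j s → Rises d j s → E j d s ≤ E j d (suc s)
E-rises (suc zero)    j s (before-middle (s≤s ()))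
E-rises (suc zero)    j s (even-middle () _)
E-rises (suc zero)    j zero (odd-middle _ _ ())
E-rises (suc zero)    j (suc s) (odd-middle () _ _)
E-rises (suc (suc D)) j s h = RisingStep.E-rises-step D (E-rises (suc D)) j s h

-- Peaks

E-falls : ∀ d i r t k → suc (i + r) ≡ d → suc (t + suc k) ≡ d → Rises d (suc r) t →
          E (suc i) d (suc k) ≤ E (suc i) d k
E-falls d i r t k i+r t+k rises = begin
  E (suc i) d (suc k)   ≡⟨ E-symmetric d i r (suc k) t i+r (trans (cong suc (+-comm (suc k) t)) t+k) ⟩
  E (suc r) d t         ≤⟨ E-rises d (suc r) t rises ⟩
  E (suc r) d (suc t)   ≡⟨ E-symmetric d r i (suc t) k (trans (cong suc (+-comm r i)) i+r)
                                                      (trans (cong suc (sym (+-suc t k))) t+k) ⟩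
  E (suc i) d k         ∎
  where open ≤-Reasoning

E-peak : ∀ d i r m → suc (i + r) ≡ d → (∀ k → k < m → Rises d (suc i) k) →
         (∀ t → 2 + (t + m) ≤ d → Rises d (suc r) t) → PeakAt (E (suc i) d) m d
E-peak (suc D) i r m i+r rises falls =
  (λ k k<m → E-rises (suc D) (suc i) k (rises k k<m)) , fall
  where
  fall : ∀ k → m ≤ k → suc k ≤ D → E (suc i) (suc D) (suc k) ≤ E (suc i) (suc D) k
  fall k m≤k k<D with t , k+t ← m≤n⇒∃[o]m+o≡n k<D =
    E-falls (suc D) i r t k i+r t+k
      (falls t (≤-trans (+-monoʳ-≤ 2 (+-monoʳ-≤ t m≤k)) (≤-reflexive (trans (cong suc (sym (+-suc t k))) t+k))))
    where
    t+k : suc (t + suc k) ≡ suc D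
    t+k = cong suc (trans (+-comm t (suc k)) k+t)

double-suc : ∀ k → suc k + suc k ≡ 2 + (k + k)
double-suc k = cong suc (+-suc k k)

rises-before-even : ∀ {n j k} → suc k < n → Rises (n + n) j k
rises-before-even {n} {k = k} 2+k≤n =
  before-middle (≤-trans (n≤1+n _) (subst (_≤ n + n) (trans (double-suc (suc k)) (cong (2 +_) (double-suc k)))
                                                  (+-mono-≤ 2+k≤n 2+k≤n)))

rises-middle-even : ∀ {n j} → suc n < j → Rises (suc n + suc n) j n
rises-middle-even {n} n<j = even-middle (sym (double-suc n)) (+-mono-< n<j n<j)

rises-before-odd : ∀ {n j k} → k < n → Rises (suc (n + n)) j k
rises-before-odd {n} {k = k} 1+k≤n = before-middle (s≤s (subst (_≤ n + n) (double-suc k) (+-mono-≤ 1+k≤n 1+k≤n)))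

rises-middle-odd : ∀ {n} → 1 ≤ n → Rises (suc (n + n)) (suc (n + n)) n
rises-middle-odd 1≤n = odd-middle refl refl 1≤n

even-peak-low : ∀ n i r → suc (i + r) ≡ suc n + suc n → i ≤ n → PeakAt (E (suc i) (suc n + suc n)) n (suc n + suc n)
even-peak-low n i r i+r i≤n = E-peak _ i r n i+r (λ k k<n → rises-before-even (s≤s k<n)) falls
  where
  n<1+r : suc n < suc r
  n<1+r = s≤s (+-cancelˡ-≤ i (suc n) r (≤-trans (+-monoˡ-≤ (suc n) i≤n) (≤-reflexive (sym (suc-injective i+r)))))
  falls : ∀ t → 2 + (t + n) ≤ suc n + suc n → Rises (suc n + suc n) (suc r) t
  falls t 2+t+n≤2n+2
    with m≤n⇒m<n∨m≡n (+-cancelʳ-≤ n t n (≤-pred (≤-pred (subst (2 + (t + n) ≤_) (double-suc n) 2+t+n≤2n+2))))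
  ... | inj₁ t<n = rises-before-even (s≤s t<n)
  ... | inj₂ refl = rises-middle-even n<1+r

even-peak-high : ∀ n i r → suc (i + r) ≡ suc n + suc n → suc n ≤ i →
                 PeakAt (E (suc i) (suc n + suc n)) (suc n) (suc n + suc n)
even-peak-high n i r i+r n<i = E-peak _ i r (suc n) i+r rises falls
  where
  rises : ∀ k → k < suc n → Rises (suc n + suc n) (suc i) k
  rises k k<1+n with m≤n⇒m<n∨m≡n (≤-pred k<1+n)
  ... | inj₁ k<n = rises-before-even (s≤s k<n)
  ... | inj₂ refl = rises-middle-even (s≤s n<i)
  falls : ∀ t → 2 + (t + suc n) ≤ suc n + suc n → Rises (suc n + suc n) (suc r) t
  falls t 2+t+n≤2n = rises-before-even (+-cancelʳ-≤ (suc n) (2 + t) (suc n) 2+t+n≤2n)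

odd-peak-middle : ∀ n i r → suc (i + r) ≡ suc (n + n) → PeakAt (E (suc i) (suc (n + n))) n (suc (n + n))
odd-peak-middle n i r i+r = E-peak _ i r n i+r (λ k → rises-before-odd)
  λ t 2+t+n≤1+2n → rises-before-odd (+-cancelʳ-≤ n (suc t) n (≤-pred 2+t+n≤1+2n))

odd-peak-first : ∀ n → PeakAt (E 1 (suc (suc n + suc n))) n (suc (suc n + suc n))
odd-peak-first n = E-peak _ 0 (suc n + suc n) n refl (λ k k<n → rises-before-odd (≤-trans k<n (n≤1+n n))) falls
  where
  falls : ∀ t → 2 + (t + n) ≤ suc (suc n + suc n) → Rises (suc (suc n + suc n)) (suc (suc n + suc n)) t
  falls t 2+t+n≤3+2n
    with m≤n⇒m<n∨m≡n (+-cancelʳ-≤ n t (suc n) (≤-pred (≤-pred (subst (2 + (t + n) ≤_) 3+2n 2+t+n≤3+2n))))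
    where
    3+2n : suc (suc n + suc n) ≡ 2 + (suc n + n)
    3+2n = cong (2 +_) (+-suc n n)
  ... | inj₁ t<1+n = rises-before-odd t<1+n
  ... | inj₂ refl  = rises-middle-odd (s≤s z≤n)

odd-peak-last : ∀ n → 1 ≤ n → PeakAt (E (suc (n + n)) (suc (n + n))) (suc n) (suc (n + n))
odd-peak-last n 1≤n = E-peak _ (n + n) 0 (suc n) (cong suc (+-identityʳ (n + n))) rises falls
  where
  rises : ∀ k → k < suc n → Rises (suc (n + n)) (suc (n + n)) k
  rises k k<1+n with m≤n⇒m<n∨m≡n (≤-pred k<1+n)
  ... | inj₁ k<n = rises-before-odd k<n
  ... | inj₂ refl = rises-middle-odd 1≤n
  falls : ∀ t → 2 + (t + suc n) ≤ suc (n + n) → Rises (suc (n + n)) 1 t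
  falls t 3+t+n≤1+2n = rises-before-odd (≤-trans (n≤1+n _) (+-cancelʳ-≤ n (2 + t) n
    (subst (_≤ n + n) (cong suc (+-suc t n)) (≤-pred 3+t+n≤1+2n))))

plateau : ∀ {f m d} → PeakAt f m d → PeakAt f (suc m) d → suc m ≤ d ∸ 1 → f m ≡ f (suc m)
plateau {m = m} (_ , falls) (rises , _) 1+m≤d-1 = ≤-antisym (rises m ≤-refl) (falls m ≤-refl 1+m≤d-1)

PeakAt-cong : ∀ {f g : ℕ → ℕ} {m d} → (∀ k → f k ≡ g k) → PeakAt f m d → PeakAt g m d
PeakAt-cong {f} {g} f≗g (rises , falls) =
  (λ k k<m → subst₂ _≤_ (f≗g k) (f≗g (suc k)) (rises k k<m)) ,
  (λ k m≤k k<d → subst₂ _≤_ (f≗g (suc k)) (f≗g k) (falls k m≤k k<d))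

a-peak : ∀ {j d d′ m} → d′ ≡ d → 1 ≤ j → j ≤ d → PeakAt (E j d) m d → PeakAt (a j d′) m d′
a-peak {d = d} refl 1≤j j≤d = PeakAt-cong {d = d} (λ k → sym (a≡E 1≤j j≤d k))

a-plateau : ∀ {j d d′ x y} → d′ ≡ d → 1 ≤ j → j ≤ d → E j d x ≡ E j d y → a j d′ x ≡ a j d′ y
a-plateau {x = x} {y} refl 1≤j j≤d e = trans (a≡E 1≤j j≤d x) (trans e (sym (a≡E 1≤j j≤d y)))

2*n≡n+n : ∀ n → 2 * n ≡ n + n
2*n≡n+n n = cong (n +_) (+-identityʳ n)

2*n+1≡1+n+n : ∀ n → 2 * n + 1 ≡ suc (n + n)
2*n+1≡1+n+n n = trans (+-comm (2 * n) 1) (cong suc (2*n≡n+n n))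

even-peaks : ∀ {d j} → 1 ≤ j → j ≤ d → ∀ n → d ≡ 2 * n →
  (j ≤ n → PeakAt (a j d) (n ∸ 1) d) × (n < j → PeakAt (a j d) n d)
even-peaks {j = suc i} _ j≤d (suc n) d≡2n =
  (λ j≤n → a-peak d≡ (s≤s z≤n) j≤d′ (even-peak-low n i _ (m+[n∸m]≡n j≤d′) (≤-pred j≤n))) ,
  (λ n<j → a-peak d≡ (s≤s z≤n) j≤d′ (even-peak-high n i _ (m+[n∸m]≡n j≤d′) (≤-pred n<j)))
  where
  d≡ = trans d≡2n (2*n≡n+n (suc n))
  j≤d′ = subst (suc i ≤_) d≡ j≤d
even-peaks {j = suc i} _ j≤d zero refl with () ← j≤d

odd-peak : ∀ {d j} → 1 ≤ j → j ≤ d → ∀ n → d ≡ 2 * n + 1 → PeakAt (a j d) n d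
odd-peak {j = suc i} _ j≤d n d≡2n+1 = a-peak d≡ (s≤s z≤n) j≤d′ (odd-peak-middle n i _ (m+[n∸m]≡n j≤d′))
  where
  d≡ = trans d≡2n+1 (2*n+1≡1+n+n n)
  j≤d′ = subst (suc i ≤_) d≡ j≤d

odd-first-peaks : ∀ n → 1 ≤ n → let d = suc (n + n) in PeakAt (a 1 d) (n ∸ 1) d × a 1 d (n ∸ 1) ≡ a 1 d n
odd-first-peaks n@(suc n′) _ =
  a-peak {d = suc (n + n)} refl ≤-refl (s≤s z≤n) (odd-peak-first n′) ,
  a-plateau {d = suc (n + n)} refl ≤-refl (s≤s z≤n)
    (plateau {d = suc (n + n)} (odd-peak-first n′) (odd-peak-middle n 0 _ refl) (s≤s (m≤m+n n′ _)))

odd-last-peaks : ∀ n → 1 ≤ n → let d = suc (n + n) in PeakAt (a d d) (n + 1) d × a d d n ≡ a d d (n + 1)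
odd-last-peaks n@(suc n′) 1≤n rewrite +-comm n 1 =
  a-peak {d = suc (n + n)} refl (s≤s z≤n) ≤-refl (odd-peak-last n 1≤n) ,
  a-plateau {d = suc (n + n)} refl (s≤s z≤n) ≤-refl
    (plateau {d = suc (n + n)} (odd-peak-middle n (n + n) 0 (cong suc (+-identityʳ _))) (odd-peak-last n 1≤n)
             (s≤s (m≤n+m (suc n′) n′)))

odd-peaks : ∀ {d j} → 1 ≤ j → j ≤ d → ∀ n → d ≡ 2 * n + 1 → 1 ≤ n →
    (j ≡ 1 → PeakAt (a j d) (n ∸ 1) d × a j d (n ∸ 1) ≡ a j d n)
  × (j ≡ d → PeakAt (a j d) (n + 1) d × a j d n ≡ a j d (n + 1))
  × (2 ≤ j → j ≤ d ∸ 1 → PeakAt (a j d) n d)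
odd-peaks 1≤j j≤d n d≡2n+1 1≤n =
  (λ j≡1 → subst (λ (j , d) → PeakAt (a j d) (n ∸ 1) d × a j d (n ∸ 1) ≡ a j d n)
                 (sym (cong₂ _,_ j≡1 d≡)) (odd-first-peaks n 1≤n)) ,
  (λ j≡d → subst (λ (j , d) → PeakAt (a j d) (n + 1) d × a j d n ≡ a j d (n + 1))
                 (sym (cong₂ _,_ (trans j≡d d≡) d≡)) (odd-last-peaks n 1≤n)) ,
  (λ _ _ → odd-peak 1≤j j≤d n d≡2n+1)
  where
  d≡ = trans d≡2n+1 (2*n+1≡1+n+n n)

parity : ∀ d → ∃ λ n → d ≡ 2 * n ⊎ d ≡ 2 * n + 1
parity zero = 0 , inj₁ refl
parity (suc d) with parity d
... | n , inj₁ d≡2n   = n , inj₂ (trans (cong suc d≡2n) (+-comm 1 (2 * n)))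
... | n , inj₂ d≡2n+1 = suc n , inj₁ (trans (cong suc d≡2n+1) (2n+2 n))
  where
  2n+2 : ∀ n → suc (2 * n + 1) ≡ 2 * suc n
  2n+2 = solve-∀

unimodal : ∀ {d j} → 1 ≤ j → j ≤ d → Unimodal (a j d) d
unimodal {d} {j} 1≤j j≤d with parity d
... | n , inj₂ d≡2n+1 = n , n≤d∸1 , odd-peak 1≤j j≤d n d≡2n+1
  where
  n≤d∸1 : n ≤ d ∸ 1
  n≤d∸1 = subst (n ≤_) (sym (trans (cong (_∸ 1) d≡2n+1) (m+n∸n≡m (2 * n) 1))) (m≤m+n n _)
... | n , inj₁ d≡2n with j ≤? n
...   | yes j≤n = n ∸ 1 , ∸-monoˡ-≤ 1 (subst (n ≤_) (sym d≡2n) (m≤m+n n _)) ,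
                  proj₁ (even-peaks 1≤j j≤d n d≡2n) j≤n
...   | no  j≰n = n , ∸-monoˡ-≤ 1 (≤-trans (≰⇒> j≰n) j≤d) ,
                  proj₂ (even-peaks 1≤j j≤d n d≡2n) (≰⇒> j≰n)

theorem3p4 : ∀ (d : ℕ) → 1 ≤ d → ∀ (j : ℕ) → 1 ≤ j → j ≤ d →
      Unimodal (a j d) d
    × (∀ (n : ℕ) → d ≡ 2 * n →
          (j ≤ n → PeakAt (a j d) (n ∸ 1) d)
        × (n < j → PeakAt (a j d) n d))
    × (∀ (n : ℕ) → d ≡ 2 * n + 1 → 1 ≤ n →
          (j ≡ 1 → PeakAt (a j d) (n ∸ 1) d × a j d (n ∸ 1) ≡ a j d n)
        × (j ≡ d → PeakAt (a j d) (n + 1) d × a j d n ≡ a j d (n + 1))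
        × (2 ≤ j → j ≤ d ∸ 1 → PeakAt (a j d) n d))
theorem3p4 d _ j 1≤j j≤d = unimodal 1≤j j≤d , even-peaks 1≤j j≤d , odd-peaks 1≤j j≤d
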